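{- Let $\Sigma$ be an alphabet, $\mathcal{P} \subseteq \Sigma^*$, $n \geq 1$, and $h := 2n-2$. If a DFA $\mathcal{A} \in \mathsf{Rec}(\mathcal{P},n)$ is $\mathsf{Rec}(\mathcal{P},n)$-minimal with respect to $\prec_h$, then $\mathcal{A}$ is $\mathsf{Rec}(\mathcal{P},n)$-minimal with respect to $\prec_{\mathcal{L}}$.
   Context: A DFA over $\Sigma$ is a tuple $(Q,\Sigma,q_{\mathsf{init}},\delta,F)$ with finite non-empty state set $Q$, initial state $q_{\mathsf{init}}$, total transition function $\delta\colon Q\times\Sigma\to Q$ and accepting set $F\subseteq Q$; $\mathcal{L}(\mathcal{A})$ is its language and $|\mathcal{A}| = |Q|$. $\mathsf{Rec}(\mathcal{P},n)$ denotes the set of DFAs over $\Sigma$ with at most $n$ states whose language contains $\mathcal{P}$. For DFAs $\mathcal{A},\mathcal{A}'$: $\mathcal{A} \prec_{\mathcal{L}} \mathcal{A}'$ iff $\mathcal{L}(\mathcal{A}) \subsetneq \mathcal{L}(\mathcal{A}')$; and for $h\in\mathbb{N}$, $\mathcal{A} \prec_h \mathcal{A}'$ iff $|\mathcal{L}(\mathcal{A})\cap\Sigma^{\leq h}| < |\mathcal{L}(\mathcal{A}')\cap\Sigma^{\leq h}|$, where $\Sigma^{\leq h}$ is the set of words of length at most $h$. For a set $S$ of DFAs and $\mathcal{A}\in S$, $\mathcal{A}$ is $S$-minimal w.r.t. a relation $\prec$ if there is no $\mathcal{A}'\in S$ with $\mathcal{A}'\prec\mathcal{A}$. -}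

module Defs where

open import Data.Nat using (ℕ; zero; suc; _+_; _≤_; _<_; _∸_; _*_)
open import Data.Fin using (Fin)
open import Data.Bool using (Bool; true; false)
open import Data.List using (List; []; _∷_; map; concatMap; _++_; filterᵇ; length; allFin)
open import Data.Product using (Σ; _×_; ∃)
open import Relation.Binary.PropositionalEquality using (_≡_)
open import Relation.Nullary using (¬_)

Word : ℕ → Set
Word k = List (Fin k)

record DFA (k : ℕ) : Set where
  field
    m     : ℕ
    init  : Fin (suc m)
    δ     : Fin (suc m) → Fin k → Fin (suc m)
    final : Fin (suc m) → Bool

  size : ℕ
  size = suc m

  run : Fin (suc m) → Word k → Fin (suc m)
  run q []       = q
  run q (a ∷ w)  = run (δ q a) w

  accepts : Word k → Bool
  accepts w = final (run init w)

open DFA public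

_∈L_ : ∀ {k} → Word k → DFA k → Set
w ∈L A = accepts A w ≡ true

Rec : ∀ {k} → (Word k → Set) → ℕ → DFA k → Set
Rec P n A = (size A ≤ n) × (∀ w → P w → w ∈L A)

_≺L_ : ∀ {k} → DFA k → DFA k → Set
A ≺L A' = (∀ w → w ∈L A → w ∈L A') × ∃ λ w → w ∈L A' × ¬ (w ∈L A)

wordsOfLength : (k l : ℕ) → List (Word k)
wordsOfLength k zero    = [] ∷ []
wordsOfLength k (suc l) = concatMap (λ a → map (a ∷_) (wordsOfLength k l)) (allFin k)

-- All words of length at most h (each exactly once): Σ^{≤h}.
wordsUpTo : (k h : ℕ) → List (Word k)
wordsUpTo k zero    = wordsOfLength k zero
wordsUpTo k (suc h) = wordsUpTo k h ++ wordsOfLength k (suc h)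

countUpTo : ∀ {k} → ℕ → DFA k → ℕ
countUpTo {k} h A = length (filterᵇ (accepts A) (wordsUpTo k h))

_≺[_]_ : ∀ {k} → DFA k → ℕ → DFA k → Set
A ≺[ h ] A' = countUpTo h A < countUpTo h A'

Minimal : ∀ {k} → (DFA k → Set) → (DFA k → DFA k → Set) → DFA k → Set
Minimal S _≺_ A = S A × (∀ A' → S A' → ¬ (A' ≺ A))

module Submission where

-- If L(B) ⊊ L(A), run A and B side by side as one automaton with |A| + |B| ≤ 2n states, in
-- which the two initial states are distinguished by a word of L(A) ∖ L(B). Moore's argument:
-- the relations "agree on all words of length < j" refine as j grows, each strict refinement
-- adds an equivalence class, and once a refinement step is trivial they never change again;
-- so they stabilise before j reaches the number of states, and distinguishable states are
-- distinguished by a word of length ≤ |A| + |B| − 2 ≤ h. As L(B) ⊆ L(A), that word is in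
-- L(A) ∖ L(B), so B ≺_h A, contradicting ≺_h-minimality of A.

open import Defs
open import Data.Nat using (ℕ; _≤_; _∸_; _*_)
open import Data.Fin using (Fin)
open import Data.List using (List)

open import Data.Bool using (Bool; true; false; not)
open import Data.Bool.Properties using (¬-not) renaming (_≟_ to _≟ᴮ_)
open import Data.Fin using (zero; suc; _↑ˡ_; _↑ʳ_; splitAt)
open import Data.Fin.Properties using (any?; all?; ¬∀⟶∃¬; pigeonhole; <⇒≢; splitAt-↑ˡ; splitAt-↑ʳ) renaming (_≟_ to _≟ᶠ_)
open import Data.List using ([]; _∷_; length; filterᵇ; map)
open import Data.List.Membership.Propositional using (_∈_)
open import Data.List.Membership.Propositional.Properties using (∈-concatMap⁺; ∈-map⁺; ∈-allFin; ∈-++⁺ˡ; ∈-++⁺ʳ)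
open import Data.List.Relation.Unary.Any as Any using (here; there)
open import Data.Nat using (zero; suc; _+_; _<_; z≤n; s≤s)
open import Data.Nat.Properties using (≤-trans; n<1+n; m≤n⇒m≤1+n; +-mono-≤; m≤n⇒m<n∨m≡n; ∸-monoˡ-≤; +-identityʳ)
open import Data.Product using (∃; ∃₂; _×_; _,_; proj₁; proj₂)
open import Data.Sum using (_⊎_; inj₁; inj₂; [_,_]′)
open import Data.Unit using (⊤; tt)
open import Data.Vec.Functional using (Vector) renaming (_∷_ to _◂_)
open import Function using (const; id; _∘_)
open import Relation.Nullary using (¬_; Dec; yes; no; contradiction; _×-dec_; ¬?)
open import Relation.Binary.PropositionalEquality using (_≡_; _≢_; refl; sym; trans; cong; subst)

module Moore {k : ℕ} (D : DFA k) where

  State : Set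
  State = Fin (size D)

  acceptsFrom : State → Word k → Bool
  acceptsFrom q w = final D (run D q w)

  Distinguishes : Word k → State → State → Set
  Distinguishes w p q = acceptsFrom p w ≢ acceptsFrom q w

  -- p ≈[ j ] q : p and q agree on every word of length < j.
  infix 4 _≈[_]_
  _≈[_]_ : State → ℕ → State → Set
  p ≈[ zero ]  q = ⊤
  p ≈[ suc j ] q = final D p ≡ final D q × (∀ a → δ D p a ≈[ j ] δ D q a)

  ≈-refl : ∀ {j p} → p ≈[ j ] p
  ≈-refl {zero}  = tt
  ≈-refl {suc j} = refl , λ a → ≈-refl

  ≈-sym : ∀ {j p q} → p ≈[ j ] q → q ≈[ j ] p
  ≈-sym {zero}  _        = tt
  ≈-sym {suc j} (e , es) = sym e , λ a → ≈-sym (es a)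

  ≈-trans : ∀ {j p q r} → p ≈[ j ] q → q ≈[ j ] r → p ≈[ j ] r
  ≈-trans {zero}  _          _          = tt
  ≈-trans {suc j} (e , es) (e′ , es′) = trans e e′ , λ a → ≈-trans (es a) (es′ a)

  ≈-pred : ∀ {j p q} → p ≈[ suc j ] q → p ≈[ j ] q
  ≈-pred {zero}  _        = tt
  ≈-pred {suc j} (e , es) = e , λ a → ≈-pred (es a)

  ≈-dec : ∀ j p q → Dec (p ≈[ j ] q)
  ≈-dec zero    p q = yes tt
  ≈-dec (suc j) p q = (final D p ≟ᴮ final D q) ×-dec all? (λ a → ≈-dec j (δ D p a) (δ D q a))

  ≈⇒agree : ∀ {j p q} → p ≈[ j ] q → ∀ w → length w < j → acceptsFrom p w ≡ acceptsFrom q w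
  ≈⇒agree {suc j} (e , es) []      _       = e
  ≈⇒agree {suc j} (e , es) (a ∷ w) (s≤s l) = ≈⇒agree (es a) w l

  ≉⇒distinguishing : ∀ {j p q} → ¬ p ≈[ j ] q → ∃ λ w → length w < j × Distinguishes w p q
  ≉⇒distinguishing {zero}  p≉q = contradiction tt p≉q
  ≉⇒distinguishing {suc j} {p} {q} p≉q with final D p ≟ᴮ final D q
  ... | no  f≢ = [] , s≤s z≤n , f≢
  ... | yes f≡ with ¬∀⟶∃¬ k _ (λ a → ≈-dec j (δ D p a) (δ D q a)) (λ es → p≉q (f≡ , es))
  ...   | a , δ≉ with ≉⇒distinguishing δ≉
  ...     | w , l , d = a ∷ w , s≤s l , d

  Stable : ℕ → Set
  Stable i = ∀ {p q} → p ≈[ i ] q → p ≈[ suc i ] q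

  stable⇒agree : ∀ {i p q} → Stable i → p ≈[ i ] q → ∀ w → acceptsFrom p w ≡ acceptsFrom q w
  stable⇒agree st e []      = proj₁ (st e)
  stable⇒agree st e (a ∷ w) = stable⇒agree st (proj₂ (st e) a) w

  Unstable : ℕ → Set
  Unstable i = ∃₂ λ p q → p ≈[ i ] q × ¬ p ≈[ suc i ] q

  stable-or-unstable : ∀ i → Stable i ⊎ Unstable i
  stable-or-unstable i with any? (λ p → any? (λ q → ≈-dec i p q ×-dec ¬? (≈-dec (suc i) p q)))
  ... | yes (p , q , e , ne) = inj₂ (p , q , e , ne)
  ... | no none = inj₁ stable
    where
      stable : Stable i
      stable {p} {q} e with ≈-dec (suc i) p q
      ... | yes e′ = e′
      ... | no  ne = contradiction (p , q , e , ne) none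

  -- A witness that ≈[ j ] has at least j + 1 classes.
  Separated : ∀ j → Vector State (suc j) → Set
  Separated j r = ∀ {a b} → a ≢ b → ¬ r a ≈[ j ] r b

  separated-zero : ∀ q → Separated zero (const q)
  separated-zero q {zero} {zero} a≢b _ = a≢b refl

  separated-cons : ∀ {j r} → Separated j r → ∀ x → (∀ c → ¬ x ≈[ suc j ] r c) → Separated (suc j) (x ◂ r)
  separated-cons sep x fresh {zero}  {zero}  a≢b = contradiction refl a≢b
  separated-cons sep x fresh {zero}  {suc c} _   = fresh c
  separated-cons sep x fresh {suc c} {zero}  _   = fresh c ∘ ≈-sym
  separated-cons sep x fresh {suc a} {suc b} a≢b = sep (a≢b ∘ cong suc) ∘ ≈-pred

  -- Of two states that are ≈[ j ] but ≉[ suc j ], one is ≉[ suc j ] to the whole family: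
  -- otherwise both would be ≈[ suc j ] to the same member.
  fresh-state : ∀ {j r} → Separated j r → Unstable j → ∃ λ x → ∀ c → ¬ x ≈[ suc j ] r c
  fresh-state {j} {r} sep (p , q , p≈q , p≉q)
    with any? (λ c → ≈-dec (suc j) p (r c)) | any? (λ c → ≈-dec (suc j) q (r c))
  ... | no p-fresh | _          = p , λ c e → p-fresh (c , e)
  ... | yes _      | no q-fresh = q , λ c e → q-fresh (c , e)
  ... | yes (c , p≈c) | yes (c′ , q≈c′) with c ≟ᶠ c′
  ...   | yes refl = contradiction (≈-trans p≈c (≈-sym q≈c′)) p≉q
  ...   | no  c≢c′ = contradiction (≈-trans (≈-sym (≈-pred p≈c)) (≈-trans p≈q (≈-pred q≈c′))) (sep c≢c′)

  refine : ∀ {j r} → Separated j r → Unstable j → ∃ (Separated (suc j))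
  refine {r = r} sep unstable with fresh-state sep unstable
  ... | x , fresh = x ◂ r , separated-cons sep x fresh

  stable-or-separated : ∀ j → (∃ λ i → i < j × Stable i) ⊎ ∃ (Separated j)
  stable-or-separated zero = inj₂ (const (init D) , separated-zero (init D))
  stable-or-separated (suc j) with stable-or-separated j
  ... | inj₁ (i , i<j , st) = inj₁ (i , m≤n⇒m≤1+n i<j , st)
  ... | inj₂ (r , sep) with stable-or-unstable j
  ...   | inj₁ st       = inj₁ (j , n<1+n j , st)
  ...   | inj₂ unstable = inj₂ (refine sep unstable)

  stable-below-size : ∃ λ i → i < size D × Stable i
  stable-below-size with stable-or-separated (size D)
  ... | inj₁ stable = stable
  ... | inj₂ (r , sep) with pigeonhole (n<1+n (size D)) r
  ...   | a , b , a<b , ra≡rb = contradiction (subst (r a ≈[ size D ]_) ra≡rb ≈-refl) (sep (<⇒≢ a<b))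

  short-distinguishing-word : ∀ {p q} w → Distinguishes w p q →
                              ∃ λ u → 2 + length u ≤ size D × Distinguishes u p q
  short-distinguishing-word w d with stable-below-size
  ... | i , i<size , st with ≉⇒distinguishing (λ e → d (stable⇒agree st e w))
  ...   | u , u<i , d′ = u , ≤-trans (s≤s u<i) i<size , d′

open Moore using (acceptsFrom; Distinguishes; short-distinguishing-word)

-- Disjoint union; its initial state is irrelevant, only the copies of init A and init B are used.
_⊕_ : ∀ {k} → DFA k → DFA k → DFA k
A ⊕ B = record
  { m     = m A + size B
  ; init  = init A ↑ˡ size B
  ; δ     = λ x a → [ (λ q → δ A q a ↑ˡ size B) , (λ q → size A ↑ʳ δ B q a) ]′ (splitAt (size A) x)
  ; final = λ x → [ final A , final B ]′ (splitAt (size A) x)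
  }

module _ {k} (A B : DFA k) where

  run-↑ˡ : ∀ q w → run (A ⊕ B) (q ↑ˡ size B) w ≡ run A q w ↑ˡ size B
  run-↑ˡ q []      = refl
  run-↑ˡ q (a ∷ w) rewrite splitAt-↑ˡ (size A) q (size B) = run-↑ˡ (δ A q a) w

  run-↑ʳ : ∀ q w → run (A ⊕ B) (size A ↑ʳ q) w ≡ size A ↑ʳ run B q w
  run-↑ʳ q []      = refl
  run-↑ʳ q (a ∷ w) rewrite splitAt-↑ʳ (size A) (size B) q = run-↑ʳ (δ B q a) w

  acceptsFrom-⊕ˡ : ∀ w → acceptsFrom (A ⊕ B) (init A ↑ˡ size B) w ≡ accepts A w
  acceptsFrom-⊕ˡ w rewrite run-↑ˡ (init A) w | splitAt-↑ˡ (size A) (run A (init A) w) (size B) = refl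

  acceptsFrom-⊕ʳ : ∀ w → acceptsFrom (A ⊕ B) (size A ↑ʳ init B) w ≡ accepts B w
  acceptsFrom-⊕ʳ w rewrite run-↑ʳ (init B) w | splitAt-↑ʳ (size A) (size B) (run B (init B) w) = refl

  ⊕-distinguishes : ∀ u → accepts A u ≢ accepts B u →
                    Distinguishes (A ⊕ B) u (init A ↑ˡ size B) (size A ↑ʳ init B)
  ⊕-distinguishes u rewrite acceptsFrom-⊕ˡ u | acceptsFrom-⊕ʳ u = id

  ⊕-distinguishes⁻ : ∀ u → Distinguishes (A ⊕ B) u (init A ↑ˡ size B) (size A ↑ʳ init B) →
                     accepts A u ≢ accepts B u
  ⊕-distinguishes⁻ u rewrite acceptsFrom-⊕ˡ u | acceptsFrom-⊕ʳ u = id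

≺L⇒short-witness : ∀ {k} (A B : DFA k) → B ≺L A →
                   ∃ λ u → 2 + length u ≤ size A + size B × u ∈L A × ¬ u ∈L B
≺L⇒short-witness A B (B⊆A , w , w∈A , w∉B)
  with short-distinguishing-word (A ⊕ B) w (⊕-distinguishes A B w λ e → w∉B (trans (sym e) w∈A))
... | u , short , d = u , short , u∈A , u∉B
  where
    differ : accepts A u ≢ accepts B u
    differ = ⊕-distinguishes⁻ A B u d

    u∉B : ¬ u ∈L B
    u∉B u∈B = differ (trans (B⊆A u u∈B) (sym u∈B))

    u∈A : u ∈L A
    u∈A = trans (¬-not differ) (cong not (¬-not u∉B))

∈-wordsOfLength : ∀ {k} (w : Word k) → w ∈ wordsOfLength k (length w)
∈-wordsOfLength         []      = here refl
∈-wordsOfLength {k = k} (a ∷ w) =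
  ∈-concatMap⁺ (λ b → map (b ∷_) (wordsOfLength k (length w)))
    (Any.map (λ { refl → ∈-map⁺ (a ∷_) (∈-wordsOfLength w) }) (∈-allFin a))

∈-wordsUpTo : ∀ {k} h (w : Word k) → length w ≤ h → w ∈ wordsUpTo k h
∈-wordsUpTo zero    []  _ = here refl
∈-wordsUpTo (suc h) w   l with m≤n⇒m<n∨m≡n l
... | inj₁ (s≤s l′) = ∈-++⁺ˡ (∈-wordsUpTo h w l′)
... | inj₂ |w|≡h    = ∈-++⁺ʳ _ (subst (λ l → w ∈ wordsOfLength _ l) |w|≡h (∈-wordsOfLength w))

module _ {X : Set} {g f : X → Bool} (g⇒f : ∀ x → g x ≡ true → f x ≡ true) where

  length-filterᵇ-mono : ∀ xs → length (filterᵇ g xs) ≤ length (filterᵇ f xs)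
  length-filterᵇ-mono []       = z≤n
  length-filterᵇ-mono (x ∷ xs) with g x in gx | f x in fx
  ... | true  | true  = s≤s (length-filterᵇ-mono xs)
  ... | true  | false = contradiction (trans (sym fx) (g⇒f x gx)) λ ()
  ... | false | true  = m≤n⇒m≤1+n (length-filterᵇ-mono xs)
  ... | false | false = length-filterᵇ-mono xs

  length-filterᵇ-< : ∀ {x xs} → x ∈ xs → ¬ g x ≡ true → f x ≡ true →
                     length (filterᵇ g xs) < length (filterᵇ f xs)
  length-filterᵇ-< {x} {_ ∷ xs} (here refl) ¬gx fx rewrite fx with g x in gx
  ... | true  = contradiction refl ¬gx
  ... | false = s≤s (length-filterᵇ-mono xs)
  length-filterᵇ-< {x} {y ∷ xs} (there x∈xs) ¬gx fx with g y in gy | f y in fy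
  ... | true  | true  = s≤s (length-filterᵇ-< x∈xs ¬gx fx)
  ... | true  | false = contradiction (trans (sym fy) (g⇒f y gy)) λ ()
  ... | false | true  = m≤n⇒m≤1+n (length-filterᵇ-< x∈xs ¬gx fx)
  ... | false | false = length-filterᵇ-< x∈xs ¬gx fx

short-witness⇒≺ : ∀ {k} (A B : DFA k) {h} u → length u ≤ h →
                  (∀ w → w ∈L B → w ∈L A) → u ∈L A → ¬ u ∈L B → B ≺[ h ] A
short-witness⇒≺ A B u |u|≤h B⊆A u∈A u∉B = length-filterᵇ-< B⊆A (∈-wordsUpTo _ u |u|≤h) u∉B u∈A

proposition1 : (k : ℕ) (P : List (Fin k) → Set) (n : ℕ) → 1 ≤ n →
    (A : DFA k) →
    Minimal (Rec P n) (λ B C → B ≺[ 2 * n ∸ 2 ] C) A →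
    Minimal (Rec P n) _≺L_ A
proposition1 k P n _ A (A∈Rec@(|A|≤n , _) , h-minimal) = A∈Rec , L-minimal
  where
    h : ℕ
    h = 2 * n ∸ 2

    L-minimal : ∀ B → Rec P n B → ¬ B ≺L A
    L-minimal B B∈Rec@(|B|≤n , _) B≺A@(B⊆A , _) with ≺L⇒short-witness A B B≺A
    ... | u , short , u∈A , u∉B = h-minimal B B∈Rec (short-witness⇒≺ A B u |u|≤h B⊆A u∈A u∉B)
      where
        |A|+|B|≤2n : size A + size B ≤ 2 * n
        |A|+|B|≤2n = subst (size A + size B ≤_) (cong (n +_) (sym (+-identityʳ n))) (+-mono-≤ |A|≤n |B|≤n)

        |u|≤h : length u ≤ h
        |u|≤h = ∸-monoˡ-≤ 2 (≤-trans short |A|+|B|≤2n)
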